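{- Let $\mathcal{L}=(L_1,L_2,P,\&_1,\swarrow^1,\nwarrow_1,\dots,\&_n,\swarrow^n,\nwarrow_n)$ be a multi-adjoint property-oriented frame and $(X,Y,\phi)$ a context of $\mathcal{L}$, i.e. sets $X$ (properties), $Y$ (objects), a map $\phi:X\times Y\to P$ and a map $|\cdot|:Y\to\{1,\dots,n\}$. Let $\phi_P:X\to\!\!\!\!\circ\; Y$ be the $\mathcal{Q}_P^{\mathcal{L}}$-relation with $|x|=0$ for $x\in X$, the given types for $y\in Y$, and $\phi_P(x,y)=\phi(x,y)\in\mathcal{Q}_P^{\mathcal{L}}(0,|y|)=P$. Then the multi-adjoint property-oriented concept lattice of $(X,Y,\phi)$ is isomorphic, as a complete lattice, to the $\infty$-fibre $(\mathcal{K}\phi_P)_\infty$ of the complete $\mathcal{Q}_P^{\mathcal{L}}$-category $\mathcal{K}\phi_P$ of fixed points of the Kan adjunction induced by $\phi_P$.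
   Context: Multi-adjoint property-oriented frame: complete lattices $L_1,L_2,P$ and for $i=1,\dots,n$ maps $\&_i:P\times L_2\to L_1$, $\swarrow^i:L_1\times L_2\to P$, $\nwarrow_i:L_1\times P\to L_2$ with $z\,\&_i\,y\le x\iff z\le x\swarrow^i y\iff y\le x\nwarrow_i z$. Quantaloid $\mathcal{Q}_P^{\mathcal{L}}$: objects $0,1,\dots,n,\infty$; $\mathcal{Q}_P^{\mathcal{L}}(0,i)=P$, $\mathcal{Q}_P^{\mathcal{L}}(i,\infty)=L_2$, $\mathcal{Q}_P^{\mathcal{L}}(0,\infty)=L_1$ ($1\le i\le n$); $\mathcal{Q}_P^{\mathcal{L}}(i,i)=\{\bot_{i,i}<\mathrm{id}_i\}$; all other hom-sets one-element; composition $v\circ u=u\,\&_i\,v$ for $u\in P=\mathcal{Q}_P^{\mathcal{L}}(0,i)$, $v\in L_2=\mathcal{Q}_P^{\mathcal{L}}(i,\infty)$, identities act as identities, other composites are bottom. Its left implication (defined by $v\circ u\le w\iff v\le w/u$) satisfies $w/u=w\nwarrow_i u$ for $u\in P$, $w\in L_1$. For a quantaloid $\mathcal{Q}$ and object-typed sets $X,Y$, a $\mathcal{Q}$-relation $\phi$ assigns $\phi(x,y)\in\mathcal{Q}(|x|,|y|)$. Regarding $X,Y$ as discrete $\mathcal{Q}$-categories, a presheaf of type $q$ on $Y$ is a map $\lambda$ with $\lambda(y)\in\mathcal{Q}(|y|,q)$; the presheaf $\mathcal{Q}$-category $\mathcal{P}Y$ has underlying order on presheaves of a fixed type equal to the pointwise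 order. The Kan adjunction $\phi^*\dashv\phi_*:\mathcal{P}X\to\mathcal{P}Y$ is given by $(\phi^*\lambda)(x)=\bigvee_{y\in Y}\lambda(y)\circ\phi(x,y)$ and $(\phi_*\mu)(y)=\bigwedge_{x\in X}\mu(x)/\phi(x,y)$. $\mathcal{K}\phi=\{\lambda\in\mathcal{P}Y\mid\phi_*\phi^*\lambda=\lambda\}$ with inherited structure, and $(\mathcal{K}\phi)_q$ is its set of elements of type $q$ with the underlying (pointwise) order. Concretely, $(\mathcal{K}\phi_P)_\infty=\{\lambda\in L_2^Y\mid \lambda=\phi_*\phi^*\lambda\}$ ordered pointwise, where for $\lambda\in L_2^Y$, $\mu\in L_1^X$: $(\phi^*\lambda)(x)=\bigvee_{y\in Y}\phi(x,y)\,\&_{|y|}\,\lambda(y)$ and $(\phi_*\mu)(y)=\bigwedge_{x\in X}\mu(x)\nwarrow_{|y|}\phi(x,y)$. The multi-adjoint property-oriented concept lattice of $(X,Y,\phi)$ is the complete lattice of fixed points of the Galois connection $\phi^*:L_2^Y\rightleftarrows L_1^X:\phi_*$ (with $\phi^*$ left adjoint for the pointwise orders), i.e. the set of pairs $(\lambda,\mu)\in L_2^Y\times L_1^X$ with $\phi^*\lambda=\mu$ and $\phi_*\mu=\lambda$, ordered by $(\lambda_1,\mu_1)\le(\lambda_2,\mu_2)$ iff $\lambda_1\le\lambda_2$ pointwise (equivalently $\mu_1\le\mu_2$ pointwise). -}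

module Defs where

open import Level using (Level; _⊔_; suc)
open import Data.Fin using (Fin)
open import Data.Product using (_×_)
open import Function.Bundles using (_⇔_)
open import Relation.Binary.Bundles using (Poset)

record CompleteLattice (c ℓ₁ ℓ₂ ι : Level) : Set (suc (c ⊔ ℓ₁ ⊔ ℓ₂ ⊔ ι)) where
  field
    poset : Poset c ℓ₁ ℓ₂
  open Poset poset public
  field
    ⋁       : {I : Set ι} → (I → Carrier) → Carrier
    ⋁-upper : {I : Set ι} (f : I → Carrier) (i : I) → f i ≤ ⋁ f
    ⋁-least : {I : Set ι} (f : I → Carrier) (x : Carrier) →
              ((i : I) → f i ≤ x) → ⋁ f ≤ x
    ⋀       : {I : Set ι} → (I → Carrier) → Carrier
    ⋀-lower : {I : Set ι} (f : I → Carrier) (i : I) → ⋀ f ≤ f i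
    ⋀-great : {I : Set ι} (f : I → Carrier) (x : Carrier) →
              ((i : I) → x ≤ f i) → x ≤ ⋀ f

record MAPOFrame (n : _) (c ℓ₁ ℓ₂ ι : Level) : Set (suc (c ⊔ ℓ₁ ⊔ ℓ₂ ⊔ ι)) where
  field
    L₁ L₂ P : CompleteLattice c ℓ₁ ℓ₂ ι
  module L₁ = CompleteLattice L₁
  module L₂ = CompleteLattice L₂
  module P  = CompleteLattice P
  field
    conj   : Fin n → P.Carrier → L₂.Carrier → L₁.Carrier
    implSW : Fin n → L₁.Carrier → L₂.Carrier → P.Carrier
    implNW : Fin n → L₁.Carrier → P.Carrier → L₂.Carrier
    adj₁   : ∀ i (x : L₁.Carrier) (y : L₂.Carrier) (z : P.Carrier) →
             (conj i z y L₁.≤ x) ⇔ (z P.≤ implSW i x y)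
    adj₂   : ∀ i (x : L₁.Carrier) (y : L₂.Carrier) (z : P.Carrier) →
             (z P.≤ implSW i x y) ⇔ (y L₂.≤ implNW i x z)

module _ {n : _} {c ℓ₁ ℓ₂ ι : Level} (𝓛 : MAPOFrame n c ℓ₁ ℓ₂ ι) where
  open MAPOFrame 𝓛

  -- The hom-sets of the quantaloid Q_P^L that are used here:
  --   Q(0,i) = P,  Q(i,∞) = L₂,  Q(0,∞) = L₁   (1 ≤ i ≤ n),
  -- composition  v ∘ u = u &_i v  :  Q(i,∞) × Q(0,i) → Q(0,∞),
  -- and its left implication  w / u = w ↖_i u  :  Q(0,∞) × Q(0,i) → Q(i,∞).
  Q0i Qi∞ Q0∞ : Set c
  Q0i = P.Carrier
  Qi∞ = L₂.Carrier
  Q0∞ = L₁.Carrier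

  compQ : Fin n → Qi∞ → Q0i → Q0∞
  compQ i v u = conj i u v

  leftImplQ : Fin n → Q0∞ → Q0i → Qi∞
  leftImplQ i w u = implNW i w u

  record Context : Set (c ⊔ suc ι) where
    field
      X  : Set ι
      Y  : Set ι
      ∣_∣ : Y → Fin n
      φ  : X → Y → P.Carrier

  module _ (K : Context) where
    open Context K

    -- Presheaves of type ∞ on Y (λ(y) ∈ Q(|y|,∞) = L₂) and
    -- of type ∞ on X (μ(x) ∈ Q(0,∞) = L₁).
    PshY : Set (c ⊔ ι)
    PshY = Y → L₂.Carrier

    PshX : Set (c ⊔ ι)
    PshX = X → L₁.Carrier

    -- Kan adjunction induced by the Q-relation φ_P (φ_P(x,y) = φ(x,y) ∈ Q(0,|y|)).
    φ^* : PshY → PshX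
    φ^* λ' x = L₁.⋁ (λ y → compQ ∣ y ∣ (λ' y) (φ x y))

    φ_* : PshX → PshY
    φ_* μ y = L₂.⋀ (λ x → leftImplQ ∣ y ∣ (μ x) (φ x y))

    _≤Y_ : PshY → PshY → Set (ℓ₂ ⊔ ι)
    _≈Y_ : PshY → PshY → Set (ℓ₁ ⊔ ι)
    λ₁ ≤Y λ₂ = ∀ y → λ₁ y L₂.≤ λ₂ y
    λ₁ ≈Y λ₂ = ∀ y → λ₁ y L₂.≈ λ₂ y

    _≤X_ : PshX → PshX → Set (ℓ₂ ⊔ ι)
    _≈X_ : PshX → PshX → Set (ℓ₁ ⊔ ι)
    μ₁ ≤X μ₂ = ∀ x → μ₁ x L₁.≤ μ₂ x
    μ₁ ≈X μ₂ = ∀ x → μ₁ x L₁.≈ μ₂ x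

    record KFibre∞ : Set (c ⊔ ℓ₁ ⊔ ℓ₂ ⊔ ι) where
      constructor kfix
      field
        pre   : PshY
        fixed : φ_* (φ^* pre) ≈Y pre

    _≤K_ : KFibre∞ → KFibre∞ → Set (ℓ₂ ⊔ ι)
    _≈K_ : KFibre∞ → KFibre∞ → Set (ℓ₁ ⊔ ι)
    a ≤K b = KFibre∞.pre a ≤Y KFibre∞.pre b
    a ≈K b = KFibre∞.pre a ≈Y KFibre∞.pre b

    record Concept : Set (c ⊔ ℓ₁ ⊔ ℓ₂ ⊔ ι) where
      constructor concept
      field
        ext  : PshY
        int  : PshX
        eq^* : φ^* ext ≈X int
        eq_* : φ_* int ≈Y ext

    _≤C_ : Concept → Concept → Set (ℓ₂ ⊔ ι)
    _≈C_ : Concept → Concept → Set (ℓ₁ ⊔ ι)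
    a ≤C b = Concept.ext a ≤Y Concept.ext b
    a ≈C b = (Concept.ext a ≈Y Concept.ext b) × (Concept.int a ≈X Concept.int b)

-- Order isomorphism (= isomorphism of complete lattices, since lattice
-- operations of a complete lattice are determined by its order).

record OrderIso {a b r r' s s' : Level}
                (A : Set a) (_≤A_ : A → A → Set r) (_≈A_ : A → A → Set r')
                (B : Set b) (_≤B_ : B → B → Set s) (_≈B_ : B → B → Set s')
                : Set (a ⊔ b ⊔ r ⊔ r' ⊔ s ⊔ s') where
  field
    to       : A → B
    from     : B → A
    to-mono  : ∀ {x y} → x ≤A y → to x ≤B to y
    from-mono : ∀ {x y} → x ≤B y → from x ≤A from y
    from∘to  : ∀ x → from (to x) ≈A x
    to∘from  : ∀ y → to (from y) ≈B y

-- A concept is determined by its extent λ, since its intent is forced to be φ^* λ;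
-- the extents are exactly the fixed points of φ_* φ^*, and both orders are the
-- pointwise order on extents. The only thing to check is that φ_* respects
-- pointwise equality, which holds because ↖ᵢ, a right adjoint, is monotone.
module Submission where

open import Defs
open import Level using (Level)
open import Data.Nat using (ℕ)
open import Data.Product using (_,_)
open import Function.Bundles using (_⇔_; Equivalence)
open import Function.Construct.Composition using (_⇔-∘_)

module _ {n : ℕ} {c ℓ₁ ℓ₂ ι : Level} (𝓛 : MAPOFrame n c ℓ₁ ℓ₂ ι) where
  open MAPOFrame 𝓛
  open Equivalence

  conj-residual : ∀ i x y z → (conj i z y L₁.≤ x) ⇔ (y L₂.≤ implNW i x z)
  conj-residual i x y z = adj₂ i x y z ⇔-∘ adj₁ i x y z

  implNW-monoˡ : ∀ i {w₁ w₂} u → w₁ L₁.≤ w₂ → implNW i w₁ u L₂.≤ implNW i w₂ u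
  implNW-monoˡ i {w₁} {w₂} u w₁≤w₂ =
    to (conj-residual i w₂ _ u)
       (L₁.trans (from (conj-residual i w₁ _ u) L₂.refl) w₁≤w₂)

  module _ (K : Context 𝓛) where
    open Context K

    φ_*-mono : ∀ {μ₁ μ₂} → _≤X_ 𝓛 K μ₁ μ₂ → _≤Y_ 𝓛 K (φ_* 𝓛 K μ₁) (φ_* 𝓛 K μ₂)
    φ_*-mono μ₁≤μ₂ y = L₂.⋀-great _ _ λ x →
      L₂.trans (L₂.⋀-lower _ x) (implNW-monoˡ ∣ y ∣ (φ x y) (μ₁≤μ₂ x))

    φ_*-cong : ∀ {μ₁ μ₂} → _≈X_ 𝓛 K μ₁ μ₂ → _≈Y_ 𝓛 K (φ_* 𝓛 K μ₁) (φ_* 𝓛 K μ₂)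
    φ_*-cong μ₁≈μ₂ y = L₂.antisym
      (φ_*-mono (λ x → L₁.reflexive (μ₁≈μ₂ x)) y)
      (φ_*-mono (λ x → L₁.reflexive (L₁.Eq.sym (μ₁≈μ₂ x))) y)

    extent-fixed : (C : Concept 𝓛 K) →
                   _≈Y_ 𝓛 K (φ_* 𝓛 K (φ^* 𝓛 K (Concept.ext C))) (Concept.ext C)
    extent-fixed (concept _ _ eq^* eq_*) y = L₂.Eq.trans (φ_*-cong eq^* y) (eq_* y)

    extentFixedPoint : Concept 𝓛 K → KFibre∞ 𝓛 K
    extentFixedPoint C = kfix (Concept.ext C) (extent-fixed C)

    fixedPointConcept : KFibre∞ 𝓛 K → Concept 𝓛 K
    fixedPointConcept (kfix λ' fixed) = concept λ' (φ^* 𝓛 K λ') (λ _ → L₁.Eq.refl) fixed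

theorem5p4 : {n : ℕ} {c ℓ₁ ℓ₂ ι : Level} (𝓛 : MAPOFrame n c ℓ₁ ℓ₂ ι) (K : Context 𝓛) →
    OrderIso (Concept 𝓛 K) (_≤C_ 𝓛 K) (_≈C_ 𝓛 K) (KFibre∞ 𝓛 K) (_≤K_ 𝓛 K) (_≈K_ 𝓛 K)
theorem5p4 𝓛 K = record
  { to        = extentFixedPoint 𝓛 K
  ; from      = fixedPointConcept 𝓛 K
  ; to-mono   = λ ext≤ → ext≤
  ; from-mono = λ pre≤ → pre≤
  ; from∘to   = λ C → (λ _ → L₂.Eq.refl) , Concept.eq^* C
  ; to∘from   = λ _ _ → L₂.Eq.refl
  }
  where open MAPOFrame 𝓛
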